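{- Let $\mathcal{K}$ be a frabjous cone and let $X$, $Y$, $Z$ be graphs. If $X$ has a strong $\mathcal{K}$-homomorphism to $Y$ and $Y$ has a strong $\mathcal{K}$-homomorphism to $Z$, then $X$ has a strong $\mathcal{K}$-homomorphism to $Z$. If $\mathcal{K}$ is also nonnegative, the analogous statement holds for weak $\mathcal{K}$-homomorphisms.
   Context: Graphs are finite, simple and loopless; $\sim$ denotes adjacency and $\not\sim$ non-adjacency (so $y\not\sim y$). A cone is a set of real symmetric matrices (of possibly varying sizes, rows/columns indexed by finite sets) closed under multiplication by positive scalars. $\mathcal{CP}$ is the set of Gram matrices of entrywise nonnegative real vectors; $\mathcal{S}_+$ is the set of positive semidefinite matrices. The contraction of an $n\times n$ matrix $M$ with respect to a partition $\{P_1,\dots,P_m\}$ of $[n]$ is the $m\times m$ matrix $N_{i,j}=\sum_{\ell\in P_i,k\in P_j}M_{\ell,k}$. A cone $\mathcal{K}$ is frabjous if: (1) $\mathcal{CP}\subseteq\mathcal{K}\subseteq\mathcal{S}_+$; (2) for each $n$ the $n\times n$ matrices in $\mathcal{K}$ form a convex set; (3) closed under taking principal submatrices; (4) closed under Kronecker product; (5) closed under conjugation by permutation matrices; (6) closed under contraction. $\mathcal{K}$ is nonnegative if all its matrices are entrywise nonnegative. For graphs $X,Y$ and matrices $H$ indexed by $V(X)\times V(Y)$ consider: (a) $\sum_{y,y'}H_{xy,x'y'}=1$ for all $x,x'\in V(X)$; (b) $H_{xy,x'y'}=0$ if $x\sim x'$ and $y\not\sim y'$; (c) $H_{xy,xy'}=0$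 if $y\neq y'$. $X$ has a strong $\mathcal{K}$-homomorphism to $Y$ (for frabjous $\mathcal{K}$) if some $H\in\mathcal{K}$ satisfies (a),(b),(c); for nonnegative frabjous $\mathcal{K}$, $X$ has a weak $\mathcal{K}$-homomorphism to $Y$ if some $H\in\mathcal{K}$ satisfies (a),(b). -}

module Defs where

open import Data.Nat using (ℕ; zero; suc) renaming (_*_ to _*ℕ_)
open import Data.Fin using (Fin; zero; suc; _<_; combine; remQuot; _≟_)
open import Data.Fin.Permutation using (Permutation′; _⟨$⟩ʳ_)
open import Data.Product using (Σ; ∃; _×_; _,_; proj₁; proj₂)
open import Relation.Nullary using (¬_; yes; no)
open import Relation.Binary.PropositionalEquality using (_≡_; _≢_)
open import Algebra.Structures using (IsCommutativeRing)
open import Relation.Binary.Structures using (IsTotalOrder)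

-- The real numbers, axiomatised as a Dedekind-complete ordered field
-- (the unique such structure up to isomorphism is ℝ).

record RealField : Set₁ where
  infixl 6 _+_
  infixl 7 _*_
  infix 4 _≤_
  field
    Carrier : Set
    _+_ _*_ : Carrier → Carrier → Carrier
    -_      : Carrier → Carrier
    0# 1#   : Carrier
    _≤_     : Carrier → Carrier → Set
    isCommutativeRing : IsCommutativeRing _≡_ _+_ _*_ -_ 0# 1#
    0≢1     : 0# ≢ 1#
    inverse : ∀ x → x ≢ 0# → ∃ λ y → x * y ≡ 1#
    isTotalOrder : IsTotalOrder _≡_ _≤_
    +-mono  : ∀ {x y} z → x ≤ y → x + z ≤ y + z
    *-pos   : ∀ {x y} → 0# ≤ x → 0# ≤ y → 0# ≤ x * y
    complete : (P : Carrier → Set) → (∃ λ x → P x) →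
               (∃ λ b → ∀ x → P x → x ≤ b) →
               ∃ λ s → (∀ x → P x → x ≤ s) ×
                       (∀ b → (∀ x → P x → x ≤ b) → s ≤ b)

  _<ᵣ_ : Carrier → Carrier → Set
  x <ᵣ y = (x ≤ y) × (x ≢ y)

record Graph : Set₁ where
  field
    n     : ℕ
    _∼_   : Fin n → Fin n → Set
    sym   : ∀ {x y} → x ∼ y → y ∼ x
    irrefl : ∀ x → ¬ (x ∼ x)

open Graph public

module _ (R : RealField) where
  open RealField R

  Matrix : ℕ → Set
  Matrix n = Fin n → Fin n → Carrier

  sumF : ∀ {n} → (Fin n → Carrier) → Carrier
  sumF {zero}  f = 0#
  sumF {suc n} f = f zero + sumF (λ i → f (suc i))

  record Cone : Set₁ where
    field
      mem : (n : ℕ) → Matrix n → Set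
      scale : ∀ {n} {M : Matrix n} (c : Carrier) → 0# <ᵣ c →
              mem n M → mem n (λ i j → c * M i j)
  open Cone public

  Symmetric : ∀ {n} → Matrix n → Set
  Symmetric M = ∀ i j → M i j ≡ M j i

  PSD : ∀ {n} → Matrix n → Set
  PSD {n} M = Symmetric M ×
    (∀ (v : Fin n → Carrier) → 0# ≤ sumF (λ i → sumF (λ j → v i * M i j * v j)))

  CP : ∀ {n} → Matrix n → Set
  CP {n} M = Σ ℕ λ k → Σ (Fin n → Fin k → Carrier) λ v →
    (∀ i l → 0# ≤ v i l) × (∀ i j → M i j ≡ sumF (λ l → v i l * v j l))

  -- Kronecker product; the pair (i,k) ∈ Fin n × Fin m is the index combine i k
  kron : ∀ {n m} → Matrix n → Matrix m → Matrix (n *ℕ m)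
  kron {n} {m} A B a b =
    A (proj₁ (remQuot {n} m a)) (proj₁ (remQuot {n} m b)) *
    B (proj₂ (remQuot {n} m a)) (proj₂ (remQuot {n} m b))

  ifEq : ∀ {m} → Fin m → Fin m → Carrier → Carrier
  ifEq i j c with i ≟ j
  ... | yes _ = c
  ... | no _  = 0#

  -- contraction w.r.t. the partition whose blocks are the fibres of p
  -- (p surjective, so all blocks nonempty)
  contract : ∀ {n m} → (Fin n → Fin m) → Matrix n → Matrix m
  contract p M i j =
    sumF (λ l → sumF (λ k → ifEq (p l) i (ifEq (p k) j (M l k))))

  record Frabjous (K : Cone) : Set where
    field
      cp⊆K  : ∀ {n} (M : Matrix n) → CP M → mem K n M
      K⊆psd : ∀ {n} (M : Matrix n) → mem K n M → PSD M
      convex : ∀ {n} (A B : Matrix n) (t : Carrier) → 0# ≤ t → t ≤ 1# →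
               mem K n A → mem K n B →
               mem K n (λ i j → t * A i j + (1# + - t) * B i j)
      principal : ∀ {n m} (M : Matrix n) (f : Fin m → Fin n) →
               (∀ i j → i < j → f i < f j) →
               mem K n M → mem K m (λ i j → M (f i) (f j))
      kronecker : ∀ {n m} (A : Matrix n) (B : Matrix m) →
               mem K n A → mem K m B → mem K (n *ℕ m) (kron A B)
      permute : ∀ {n} (M : Matrix n) (σ : Permutation′ n) →
               mem K n M → mem K n (λ i j → M (σ ⟨$⟩ʳ i) (σ ⟨$⟩ʳ j))
      contraction : ∀ {n m} (M : Matrix n) (p : Fin n → Fin m) →
               (∀ i → ∃ λ l → p l ≡ i) →
               mem K n M → mem K m (contract p M)

  Nonnegative : Cone → Set
  Nonnegative K = ∀ {n} (M : Matrix n) → mem K n M → ∀ i j → 0# ≤ M i j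

  -- H indexed by V(X)×V(Y), pair (x,y) encoded as combine x y
  module _ (X Y : Graph) where
    HMat : Set
    HMat = Matrix (n X *ℕ n Y)

    entry : HMat → Fin (n X) → Fin (n Y) → Fin (n X) → Fin (n Y) → Carrier
    entry H x y x' y' = H (combine x y) (combine x' y')

    condA : HMat → Set
    condA H = ∀ x x' → sumF (λ y → sumF (λ y' → entry H x y x' y')) ≡ 1#

    condB : HMat → Set
    condB H = ∀ x x' y y' → _∼_ X x x' → ¬ (_∼_ Y y y') → entry H x y x' y' ≡ 0#

    condC : HMat → Set
    condC H = ∀ x y y' → y ≢ y' → entry H x y x y' ≡ 0#

  StrongHom : Cone → Graph → Graph → Set
  StrongHom K X Y = Σ (HMat X Y) λ H →
    mem K (n X *ℕ n Y) H × condA X Y H × condB X Y H × condC X Y H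

  WeakHom : Cone → Graph → Graph → Set
  WeakHom K X Y = Σ (HMat X Y) λ H →
    mem K (n X *ℕ n Y) H × condA X Y H × condB X Y H

-- The composite of H : X → Y and G : Y → Z is N with
--   N[(x,z),(x',z')] = Σ_{y,y'} H[(x,y),(x',y')] · G[(y,z),(y',z')],
-- which lies in K because it is the contraction, along (x,y,z) ↦ (x,z), of the
-- principal submatrix of H ⊗ G on the indices ((x,y),(y,z)).  Summing over z, z'
-- uses (a) for G and then (a) for H.  A term of N vanishes under the hypotheses
-- of (b) (resp. (c)) because H or G does, according to whether y ∼ y' (resp.
-- y = y').  Adjacency is not decidable here, so this case split is justified by
-- the ¬¬-stability of x ≡ 0, which holds in a Dedekind-complete ordered field.

module Submission where

open import Defs hiding (sym)
open import Data.Nat as ℕ using (ℕ; zero; suc)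
open import Data.Nat.Properties using (+-monoʳ-<; +-cancelˡ-<; <-asym)
open import Data.Fin using (Fin; zero; suc; _<_; _↑ˡ_; _↑ʳ_; combine; quotient; remainder; toℕ; _≟_)
open import Data.Fin.Properties
  using (<-cmp; suc-injective; toℕ-combine; combine-injective; combine-monoˡ-<; combine-remQuot;
         remQuot-combine)
open import Data.Product using (∃; _×_; _,_; proj₁; proj₂; uncurry)
open import Data.Sum using (_⊎_; inj₁; inj₂)
open import Data.Empty using (⊥-elim)
open import Function using (_∘_)
open import Relation.Nullary using (¬_; yes; no)
open import Relation.Binary.Definitions using (tri<; tri≈; tri>)
open import Relation.Binary.PropositionalEquality
  using (_≡_; _≢_; refl; sym; trans; cong; cong₂; subst; subst₂; module ≡-Reasoning)
open import Relation.Binary.Structures using (IsTotalOrder)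
open import Algebra.Bundles using (CommutativeRing)
open import Algebra.Structures using (IsCommutativeRing)
import Algebra.Properties.Ring as RingProperties
import Algebra.Properties.Semiring.Sum as SemiringSum

combine-monoʳ-< : ∀ {m n} (i : Fin m) {j l : Fin n} → j < l → combine i j < combine i l
combine-monoʳ-< {n = n} i {j} {l} j<l =
  subst₂ ℕ._<_ (sym (toℕ-combine i j)) (sym (toℕ-combine i l)) (+-monoʳ-< (n ℕ.* toℕ i) j<l)

combine-<-lex : ∀ {m n} (i k : Fin m) (j l : Fin n) →
  combine i j < combine k l → i < k ⊎ (i ≡ k × j < l)
combine-<-lex {n = n} i k j l ij<kl with <-cmp i k
... | tri< i<k _ _  = inj₁ i<k
... | tri≈ _ refl _ = inj₂ (refl , +-cancelˡ-< (n ℕ.* toℕ i) (toℕ j) (toℕ l)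
                                     (subst₂ ℕ._<_ (toℕ-combine i j) (toℕ-combine i l) ij<kl))
... | tri> _ _ k<i  = ⊥-elim (<-asym (combine-monoˡ-< l j k<i) ij<kl)

-- The map (i , j) ↦ (i , h i j) on Fin (m * n), in the encoding by combine.
lexMap : ∀ {m n k} → (Fin m → Fin n → Fin k) → Fin (m ℕ.* n) → Fin (m ℕ.* k)
lexMap {m} {n} h i = combine (quotient {m} n i) (h (quotient {m} n i) (remainder {m} n i))

lexMap-combine : ∀ {m n k} (h : Fin m → Fin n → Fin k) i j → lexMap h (combine i j) ≡ combine i (h i j)
lexMap-combine {m} {n} h i j = cong (uncurry λ q r → combine q (h q r)) (remQuot-combine {m} {n} i j)

lexMap-strictlyMono : ∀ {m n k} {h : Fin m → Fin n → Fin k} →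
  (∀ i {j l} → j < l → h i j < h i l) → ∀ {a b} → a < b → lexMap h a < lexMap h b
lexMap-strictlyMono {m} {n} {h = h} h-mono {a} {b} =
  subst₂ (λ a b → a < b → lexMap h a < lexMap h b)
    (combine-remQuot {m} n a) (combine-remQuot {m} n b) (on-combine _ _ _ _)
  where
  on-combine : ∀ i j i' j' → combine i j < combine i' j' →
    lexMap h (combine i j) < lexMap h (combine i' j')
  on-combine i j i' j' lt rewrite lexMap-combine h i j | lexMap-combine h i' j'
    with combine-<-lex i i' j j' lt
  ... | inj₁ i<i'        = combine-monoˡ-< _ _ i<i'
  ... | inj₂ (refl , j<j') = combine-monoʳ-< i (h-mono i j<j')

module _ (R : RealField) where
  open RealField R
  open IsCommutativeRing isCommutativeRing
    using (+-assoc; +-identityˡ; +-identityʳ; -‿inverseˡ; -‿inverseʳ; zeroˡ; zeroʳ; *-identityʳ)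
  open IsTotalOrder isTotalOrder using (antisym; total)

  commutativeRing : CommutativeRing _ _
  commutativeRing = record { isCommutativeRing = isCommutativeRing }

  open RingProperties (CommutativeRing.ring commutativeRing)
    using (-0#≈0#; -‿involutive; -1*x≈-x; xyx⁻¹≈y; //-rightDividesˡ)
  open SemiringSum (CommutativeRing.semiring commutativeRing)
    using (sum; sum-syntax; sum-cong-≗; sum-replicate-zero; ∑-comm; *-distribˡ-sum)

  1≰0 : ¬ (1# ≤ 0#)
  1≰0 1≤0 = 0≢1 (antisym 0≤1 1≤0)
    where
    0≤-1 : 0# ≤ - 1#
    0≤-1 = subst₂ _≤_ (-‿inverseʳ 1#) (+-identityˡ (- 1#)) (+-mono (- 1#) 1≤0)
    0≤1 : 0# ≤ 1#
    0≤1 = subst (0# ≤_) (trans (-1*x≈-x (- 1#)) (-‿involutive 1#)) (*-pos 0≤-1 0≤-1)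

  -- If ¬¬ (x ≡ 0) then all multiples k·x are ≤ 1, so they have a supremum s;
  -- s - x is again an upper bound, whence s ≤ s - x and x ≤ 0.
  ¬¬≡0⇒≤0 : ∀ x → ¬ ¬ (x ≡ 0#) → x ≤ 0#
  ¬¬≡0⇒≤0 x ¬¬x≡0 = subst₂ _≤_ (xyx⁻¹≈y s x) (-‿inverseʳ s) (+-mono (- s) s+x≤s)
    where
    IsMultiple : Carrier → Set
    IsMultiple t = ∃ λ k → t ≡ ∑[ _ < k ] x

    multiple≤1 : ∀ t → IsMultiple t → t ≤ 1#
    multiple≤1 _ (k , refl) with total (∑[ _ < k ] x) 1#
    ... | inj₁ kx≤1 = kx≤1
    ... | inj₂ 1≤kx = ⊥-elim (¬¬x≡0 λ x≡0 →
      1≰0 (subst (1# ≤_) (trans (sum-cong-≗ {k} (λ _ → x≡0)) (sum-replicate-zero k)) 1≤kx))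

    supremum = complete IsMultiple (0# , zero , refl) (1# , multiple≤1)
    s = proj₁ supremum

    multiple≤s-x : ∀ t → IsMultiple t → t ≤ s + - x
    multiple≤s-x _ (k , refl) =
      subst (_≤ s + - x) (xyx⁻¹≈y x _) (+-mono (- x) (proj₁ (proj₂ supremum) _ (suc k , refl)))

    s+x≤s : s + x ≤ s
    s+x≤s = subst (s + x ≤_) (//-rightDividesˡ x s) (+-mono x (proj₂ (proj₂ supremum) _ multiple≤s-x))

  ≡0-stable : ∀ x → ¬ ¬ (x ≡ 0#) → x ≡ 0#
  ≡0-stable x ¬¬x≡0 = antisym (¬¬≡0⇒≤0 x ¬¬x≡0) 0≤x
    where
    -x≤0 : - x ≤ 0#
    -x≤0 = ¬¬≡0⇒≤0 (- x) λ -x≢0 → ¬¬x≡0 λ x≡0 → -x≢0 (trans (cong -_ x≡0) -0#≈0#)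
    0≤x : 0# ≤ x
    0≤x = subst₂ _≤_ (-‿inverseˡ x) (+-identityˡ x) (+-mono x -x≤0)

  *≡0-byCases : ∀ {a b} (P : Set) → (P → b ≡ 0#) → (¬ P → a ≡ 0#) → a * b ≡ 0#
  *≡0-byCases {a} {b} P b≡0 a≡0 = ≡0-stable _ λ ab≢0 →
    ab≢0 (trans (cong (_* b) (a≡0 λ p → ab≢0 (trans (cong (a *_) (b≡0 p)) (zeroʳ a)))) (zeroˡ b))

  sumF≡sum : ∀ {n} (f : Fin n → Carrier) → sumF R f ≡ sum f
  sumF≡sum {zero}  f = refl
  sumF≡sum {suc n} f = cong (f zero +_) (sumF≡sum (f ∘ suc))

  sumF²≡sum² : ∀ {m n} (f : Fin m → Fin n → Carrier) →
    sumF R (λ i → sumF R (f i)) ≡ ∑[ i < m ] ∑[ j < n ] f i j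
  sumF²≡sum² f = trans (sumF≡sum (λ i → sumF R (f i))) (sum-cong-≗ (λ i → sumF≡sum (f i)))

  *-distribˡ-sum² : ∀ {m n} x (f : Fin m → Fin n → Carrier) →
    x * (∑[ i < m ] ∑[ j < n ] f i j) ≡ ∑[ i < m ] ∑[ j < n ] (x * f i j)
  *-distribˡ-sum² x f =
    trans (*-distribˡ-sum x (λ i → sum (f i))) (sum-cong-≗ (λ i → *-distribˡ-sum x (f i)))

  sum-zero : ∀ {n} {f : Fin n → Carrier} → (∀ i → f i ≡ 0#) → sum f ≡ 0#
  sum-zero {n} f≡0 = trans (sum-cong-≗ f≡0) (sum-replicate-zero n)

  sum-↑ : ∀ m {n} (f : Fin (m ℕ.+ n) → Carrier) →
    sum f ≡ ∑[ i < m ] f (i ↑ˡ n) + ∑[ j < n ] f (m ↑ʳ j)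
  sum-↑ zero    f = sym (+-identityˡ _)
  sum-↑ (suc m) f = trans (cong (f zero +_) (sum-↑ m (f ∘ suc))) (sym (+-assoc _ _ _))

  sum-combine : ∀ m n (f : Fin (m ℕ.* n) → Carrier) → sum f ≡ ∑[ i < m ] ∑[ j < n ] f (combine i j)
  sum-combine zero    n f = refl
  sum-combine (suc m) n f =
    trans (sum-↑ n {m ℕ.* n} f)
          (cong (∑[ j < n ] f (j ↑ˡ (m ℕ.* n)) +_) (sum-combine m n (f ∘ (n ↑ʳ_))))

  ∑-comm² : ∀ {m n k l} (f : Fin m → Fin n → Fin k → Fin l → Carrier) →
    ∑[ i < m ] ∑[ j < n ] ∑[ p < k ] ∑[ q < l ] f i j p q ≡
    ∑[ p < k ] ∑[ q < l ] ∑[ i < m ] ∑[ j < n ] f i j p q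
  ∑-comm² f = begin
    ∑[ i < _ ] ∑[ j < _ ] ∑[ p < _ ] ∑[ q < _ ] f i j p q
      ≡⟨ sum-cong-≗ (λ i → ∑-comm (λ j p → sum (f i j p))) ⟩
    ∑[ i < _ ] ∑[ p < _ ] ∑[ j < _ ] ∑[ q < _ ] f i j p q
      ≡⟨ sum-cong-≗ (λ i → sum-cong-≗ (λ p → ∑-comm (λ j → f i j p))) ⟩
    ∑[ i < _ ] ∑[ p < _ ] ∑[ q < _ ] ∑[ j < _ ] f i j p q
      ≡⟨ ∑-comm (λ i p → ∑[ q < _ ] ∑[ j < _ ] f i j p q) ⟩
    ∑[ p < _ ] ∑[ i < _ ] ∑[ q < _ ] ∑[ j < _ ] f i j p q
      ≡⟨ sum-cong-≗ (λ p → ∑-comm (λ i q → ∑[ j < _ ] f i j p q)) ⟩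
    ∑[ p < _ ] ∑[ q < _ ] ∑[ i < _ ] ∑[ j < _ ] f i j p q ∎
    where open ≡-Reasoning

  ifEq-≡ : ∀ {m} (i j : Fin m) c → i ≡ j → ifEq R i j c ≡ c
  ifEq-≡ i j c i≡j with i ≟ j
  ... | yes _   = refl
  ... | no i≢j = ⊥-elim (i≢j i≡j)

  ifEq-≢ : ∀ {m} (i j : Fin m) c → i ≢ j → ifEq R i j c ≡ 0#
  ifEq-≢ i j c i≢j with i ≟ j
  ... | yes i≡j = ⊥-elim (i≢j i≡j)
  ... | no _    = refl

  ifEq-sum : ∀ {m n} (i j : Fin m) (f : Fin n → Carrier) →
    ifEq R i j (sum f) ≡ ∑[ k < n ] ifEq R i j (f k)
  ifEq-sum {n = n} i j f with i ≟ j
  ... | yes _ = refl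
  ... | no _  = sym (sum-replicate-zero n)

  ifEq-injective : ∀ {m n} {f : Fin m → Fin n} → (∀ {i j} → f i ≡ f j → i ≡ j) →
    ∀ i j c → ifEq R (f i) (f j) c ≡ ifEq R i j c
  ifEq-injective {f = f} f-inj i j c with i ≟ j
  ... | yes i≡j = ifEq-≡ (f i) (f j) c (cong f i≡j)
  ... | no i≢j  = ifEq-≢ (f i) (f j) c (i≢j ∘ f-inj)

  ifEq-combine : ∀ {m n} (i i' : Fin m) (j j' : Fin n) c →
    ifEq R (combine i j) (combine i' j') c ≡ ifEq R i i' (ifEq R j j' c)
  ifEq-combine i i' j j' c with i ≟ i' | j ≟ j'
  ... | yes refl | yes refl = ifEq-≡ (combine i j) (combine i j) c refl
  ... | yes refl | no j≢j'  =
    ifEq-≢ (combine i j) (combine i j') c (j≢j' ∘ proj₂ ∘ combine-injective i j i j')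
  ... | no i≢i'  | _        =
    ifEq-≢ (combine i j) (combine i' j') c (i≢i' ∘ proj₁ ∘ combine-injective i j i' j')

  sum-ifEq : ∀ {n} (j : Fin n) (f : Fin n → Carrier) → ∑[ i < n ] ifEq R i j (f i) ≡ f j
  sum-ifEq {suc n} zero f =
    trans (cong₂ _+_ (ifEq-≡ (zero {n}) zero (f zero) refl)
                     (sum-zero (λ i → ifEq-≢ (suc i) zero (f (suc i)) λ ())))
          (+-identityʳ (f zero))
  sum-ifEq {suc n} (suc j) f =
    trans (cong₂ _+_ (ifEq-≢ zero (suc j) (f zero) λ ())
                     (trans (sum-cong-≗ (λ i → ifEq-injective suc-injective i j _)) (sum-ifEq j (f ∘ suc))))
          (+-identityˡ (f (suc j)))

  sum-ifEq-combine : ∀ {m n} (i : Fin m) (j : Fin n) (f : Fin m → Fin n → Carrier) →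
    ∑[ u < m ] ∑[ v < n ] ifEq R (combine u v) (combine i j) (f u v) ≡ f i j
  sum-ifEq-combine {m} {n} i j f = begin
    ∑[ u < m ] ∑[ v < n ] ifEq R (combine u v) (combine i j) (f u v)
      ≡⟨ sum-cong-≗ (λ u → sum-cong-≗ (λ v → ifEq-combine u i v j _)) ⟩
    ∑[ u < m ] ∑[ v < n ] ifEq R u i (ifEq R v j (f u v))
      ≡⟨ sum-cong-≗ (λ u → sym (ifEq-sum u i (λ v → ifEq R v j (f u v)))) ⟩
    ∑[ u < m ] ifEq R u i (∑[ v < n ] ifEq R v j (f u v))
      ≡⟨ sum-cong-≗ (λ u → cong (ifEq R u i) (sum-ifEq j (f u))) ⟩
    ∑[ u < m ] ifEq R u i (f u j)
      ≡⟨ sum-ifEq i (λ u → f u j) ⟩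
    f i j ∎
    where open ≡-Reasoning

  contract-fibres : ∀ {n m} (p : Fin n → Fin m) (M : Matrix R n) i j →
    contract R p M i j ≡ ∑[ l < n ] ifEq R (p l) i (∑[ k < n ] ifEq R (p k) j (M l k))
  contract-fibres p M i j =
    trans (sumF²≡sum² (λ l k → ifEq R (p l) i (ifEq R (p k) j (M l k))))
          (sum-cong-≗ (λ l → sym (ifEq-sum (p l) i (λ k → ifEq R (p k) j (M l k)))))

  kron-combine : ∀ {m n} (A : Matrix R m) (B : Matrix R n) u v u' v' →
    kron R A B (combine u v) (combine u' v') ≡ A u u' * B v v'
  kron-combine {m} {n} A B u v u' v' =
    cong₂ (λ r r' → A (proj₁ r) (proj₁ r') * B (proj₂ r) (proj₂ r'))
          (remQuot-combine {m} {n} u v) (remQuot-combine {m} {n} u' v')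

  sum≡1⇒inhabited : ∀ {n} (f : Fin n → Carrier) → sumF R f ≡ 1# → Fin n
  sum≡1⇒inhabited {zero}  f 0≡1 = ⊥-elim (0≢1 0≡1)
  sum≡1⇒inhabited {suc n} f _   = zero

  module Composition (X Y Z : Graph) where

    a b c : ℕ
    a = n X
    b = n Y
    c = n Z

    -- With pairs encoded by combine: link ((x,y),z) = (y,z), chain ((x,y),z) =
    -- ((x,y),(y,z)) and ends ((x,y),z) = (x,z).
    link : Fin (a ℕ.* b) → Fin c → Fin (b ℕ.* c)
    link u z = combine (remainder {a} b u) z

    chain : Fin ((a ℕ.* b) ℕ.* c) → Fin ((a ℕ.* b) ℕ.* (b ℕ.* c))
    chain = lexMap link

    ends : Fin ((a ℕ.* b) ℕ.* c) → Fin (a ℕ.* c)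
    ends i = combine (quotient {a} b (quotient {a ℕ.* b} c i)) (remainder {a ℕ.* b} c i)

    chain-combine : ∀ (x : Fin a) (y : Fin b) (z : Fin c) →
      chain (combine (combine x y) z) ≡ combine (combine x y) (combine y z)
    chain-combine x y z = trans (lexMap-combine link (combine x y) z)
      (cong (λ r → combine (combine x y) (combine r z)) (cong proj₂ (remQuot-combine {a} {b} x y)))

    ends-combine : ∀ (x : Fin a) (y : Fin b) (z : Fin c) →
      ends (combine (combine x y) z) ≡ combine x z
    ends-combine x y z =
      trans (cong (uncurry λ u z → combine (quotient {a} b u) z)
                  (remQuot-combine {a ℕ.* b} {c} (combine x y) z))
            (cong (λ q → combine q z) (cong proj₁ (remQuot-combine {a} {b} x y)))

    chain-strictlyMono : ∀ i j → i < j → chain i < chain j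
    chain-strictlyMono i j = lexMap-strictlyMono (λ u → combine-monoʳ-< (remainder {a} b u))

    ends-surjective : (Fin a → Fin b) → ∀ t → ∃ λ l → ends l ≡ t
    ends-surjective y t =
      combine (combine x (y x)) z , trans (ends-combine x (y x) z) (combine-remQuot {a} c t)
      where
      x = quotient {a} c t
      z = remainder {a} c t

    sum-fibre-ends : ∀ (f : Fin ((a ℕ.* b) ℕ.* c) → Carrier) (x : Fin a) (z : Fin c) →
      ∑[ k < (a ℕ.* b) ℕ.* c ] ifEq R (ends k) (combine x z) (f k) ≡
      ∑[ y < b ] f (combine (combine x y) z)
    sum-fibre-ends f x z = begin
      ∑[ k < _ ] ifEq R (ends k) t (f k)
        ≡⟨ sum-combine (a ℕ.* b) c _ ⟩
      ∑[ u < a ℕ.* b ] ∑[ z' < c ] ifEq R (ends (combine u z')) t (f (combine u z'))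
        ≡⟨ sum-combine a b _ ⟩
      ∑[ x' < a ] ∑[ y < b ] ∑[ z' < c ] ifEq R (ends (combine (combine x' y) z')) t (f′ x' y z')
        ≡⟨ sum-cong-≗ (λ x' → sum-cong-≗ (λ y → sum-cong-≗ (λ z' →
             cong (λ e → ifEq R e t (f′ x' y z')) (ends-combine x' y z')))) ⟩
      ∑[ x' < a ] ∑[ y < b ] ∑[ z' < c ] ifEq R (combine x' z') t (f′ x' y z')
        ≡⟨ ∑-comm (λ x' y → ∑[ z' < c ] ifEq R (combine x' z') t (f′ x' y z')) ⟩
      ∑[ y < b ] ∑[ x' < a ] ∑[ z' < c ] ifEq R (combine x' z') t (f′ x' y z')
        ≡⟨ sum-cong-≗ (λ y → sum-ifEq-combine x z (λ x' z' → f′ x' y z')) ⟩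
      ∑[ y < b ] f′ x y z ∎
      where
      open ≡-Reasoning
      t : Fin (a ℕ.* c)
      t = combine x z
      f′ : Fin a → Fin b → Fin c → Carrier
      f′ x' y z' = f (combine (combine x' y) z')

    compose : HMat R X Y → HMat R Y Z → HMat R X Z
    compose H G = contract R ends (λ i j → kron R H G (chain i) (chain j))

    compose-entry : ∀ H G x z x' z' → entry R X Z (compose H G) x z x' z' ≡
      ∑[ y < b ] ∑[ y' < b ] (entry R X Y H x y x' y' * entry R Y Z G y z y' z')
    compose-entry H G x z x' z' = begin
      contract R ends M (combine x z) (combine x' z')
        ≡⟨ contract-fibres ends M _ _ ⟩
      ∑[ l < _ ] ifEq R (ends l) (combine x z) (∑[ k < _ ] ifEq R (ends k) (combine x' z') (M l k))
        ≡⟨ sum-cong-≗ (λ l → cong (ifEq R (ends l) (combine x z)) (sum-fibre-ends (M l) x' z')) ⟩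
      ∑[ l < _ ] ifEq R (ends l) (combine x z) (∑[ y' < b ] M l (combine (combine x' y') z'))
        ≡⟨ sum-fibre-ends _ x z ⟩
      ∑[ y < b ] ∑[ y' < b ] M (combine (combine x y) z) (combine (combine x' y') z')
        ≡⟨ sum-cong-≗ (λ y → sum-cong-≗ (λ y' →
             trans (cong₂ (kron R H G) (chain-combine x y z) (chain-combine x' y' z'))
                   (kron-combine H G _ _ _ _))) ⟩
      ∑[ y < b ] ∑[ y' < b ] (entry R X Y H x y x' y' * entry R Y Z G y z y' z') ∎
      where
      open ≡-Reasoning
      M : Matrix R ((a ℕ.* b) ℕ.* c)
      M i j = kron R H G (chain i) (chain j)

    compose-condA : ∀ H G → condA R X Y H → condA R Y Z G → condA R X Z (compose H G)
    compose-condA H G aH aG x x' = begin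
      sumF R (λ z → sumF R (λ z' → entry R X Z (compose H G) x z x' z'))
        ≡⟨ sumF²≡sum² (λ z z' → entry R X Z (compose H G) x z x' z') ⟩
      ∑[ z < c ] ∑[ z' < c ] entry R X Z (compose H G) x z x' z'
        ≡⟨ sum-cong-≗ (λ z → sum-cong-≗ (λ z' → compose-entry H G x z x' z')) ⟩
      ∑[ z < c ] ∑[ z' < c ] ∑[ y < b ] ∑[ y' < b ] (h y y' * g y z y' z')
        ≡⟨ ∑-comm² (λ z z' y y' → h y y' * g y z y' z') ⟩
      ∑[ y < b ] ∑[ y' < b ] ∑[ z < c ] ∑[ z' < c ] (h y y' * g y z y' z')
        ≡⟨ sum-cong-≗ (λ y → sum-cong-≗ (λ y' →
             sym (*-distribˡ-sum² (h y y') (λ z z' → g y z y' z')))) ⟩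
      ∑[ y < b ] ∑[ y' < b ] (h y y' * (∑[ z < c ] ∑[ z' < c ] g y z y' z'))
        ≡⟨ sum-cong-≗ (λ y → sum-cong-≗ (λ y' →
             trans (cong (h y y' *_) (trans (sym (sumF²≡sum² (λ z z' → g y z y' z'))) (aG y y')))
                   (*-identityʳ _))) ⟩
      ∑[ y < b ] ∑[ y' < b ] h y y'
        ≡⟨ trans (sym (sumF²≡sum² h)) (aH x x') ⟩
      1# ∎
      where
      open ≡-Reasoning
      h : Fin b → Fin b → Carrier
      h y y' = entry R X Y H x y x' y'
      g : Fin b → Fin c → Fin b → Fin c → Carrier
      g = entry R Y Z G

    compose-condB : ∀ H G → condB R X Y H → condB R Y Z G → condB R X Z (compose H G)
    compose-condB H G bH bG x x' z z' x∼x' z≁z' =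
      trans (compose-entry H G x z x' z') (sum-zero λ y → sum-zero λ y' →
        *≡0-byCases (_∼_ Y y y') (λ y∼y' → bG y y' z z' y∼y' z≁z') (bH x x' y y' x∼x'))

    compose-condC : ∀ H G → condC R X Y H → condC R Y Z G → condC R X Z (compose H G)
    compose-condC H G cH cG x z z' z≢z' =
      trans (compose-entry H G x z x z') (sum-zero λ y → sum-zero λ y' → term y y')
      where
      term : ∀ y y' → entry R X Y H x y x y' * entry R Y Z G y z y' z' ≡ 0#
      term y y' with y ≟ y'
      ... | yes refl = trans (cong (_ *_) (cG y z z' z≢z')) (zeroʳ _)
      ... | no y≢y'  = trans (cong (_* _) (cH x y y' y≢y')) (zeroˡ _)

    compose-mem : ∀ {K} H G → Frabjous R K → condA R X Y H →
      mem K (a ℕ.* b) H → mem K (b ℕ.* c) G → mem K (a ℕ.* c) (compose H G)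
    compose-mem H G frabjous aH H∈K G∈K =
      contraction _ ends (ends-surjective λ x → sum≡1⇒inhabited _ (aH x x))
        (principal (kron R H G) chain chain-strictlyMono (kronecker H G H∈K G∈K))
      where open Frabjous frabjous

mainTheorem5 : (R : RealField) (K : Cone R) → Frabjous R K → (X Y Z : Graph) →
    (StrongHom R K X Y → StrongHom R K Y Z → StrongHom R K X Z) ×
    (Nonnegative R K → WeakHom R K X Y → WeakHom R K Y Z → WeakHom R K X Z)
mainTheorem5 R K frabjous X Y Z = strong , weak
  where
  open Composition R X Y Z

  strong : StrongHom R K X Y → StrongHom R K Y Z → StrongHom R K X Z
  strong (H , H∈K , aH , bH , cH) (G , G∈K , aG , bG , cG) =
    compose H G , compose-mem H G frabjous aH H∈K G∈K ,
    compose-condA H G aH aG , compose-condB H G bH bG , compose-condC H G cH cG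

  weak : Nonnegative R K → WeakHom R K X Y → WeakHom R K Y Z → WeakHom R K X Z
  weak _ (H , H∈K , aH , bH) (G , G∈K , aG , bG) =
    compose H G , compose-mem H G frabjous aH H∈K G∈K , compose-condA H G aH aG , compose-condB H G bH bG
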